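{- Let $G_1$ and $G_2$ be finite simple graphs with nonempty vertex sets and let $G=G_1\square G_2$. Then $G$ is regular and $K_3$-regular if and only if both $G_1$ and $G_2$ are regular and $K_3$-regular.
   Context: The Cartesian product $G_1\square G_2$ has vertex set $V(G_1)\times V(G_2)$, with $(u,v)$ and $(u',v')$ adjacent iff either $u=u'$ and $vv'\in E(G_2)$, or $v=v'$ and $uu'\in E(G_1)$. A graph is regular if all vertices have the same degree, and $K_3$-regular if all vertices have the same $K_3$-degree, where the $K_3$-degree of a vertex is the number of triangles containing it. -}

module Defs where

open import Data.Nat using (ℕ; suc; _*_; _<_)
open import Data.Fin using (Fin; toℕ; _<?_)
open import Data.Fin.Properties using (_≟_)
open import Data.Product using (_×_; _,_; Σ; proj₁; proj₂)
open import Data.List using (List; filter; length; allFin; cartesianProduct)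
open import Relation.Nullary using (¬_; Dec; yes; no)
open import Relation.Nullary.Decidable using (_×-dec_)
open import Relation.Binary.PropositionalEquality using (_≡_)

record Graph : Set₁ where
  field
    n     : ℕ
    Adj   : Fin n → Fin n → Set
    adj?  : ∀ u v → Dec (Adj u v)
    irrefl : ∀ v → ¬ Adj v v
    sym   : ∀ {u v} → Adj u v → Adj v u

open Graph public

degree : (G : Graph) → Fin (n G) → ℕ
degree G v = length (filter (adj? G v) (allFin (n G)))

-- K3-degree of v: number of triangles containing v, i.e. number of
-- unordered pairs {u , w} (counted with u < w) such that v, u, w are
-- pairwise adjacent.
K3-degree : (G : Graph) → Fin (n G) → ℕ
K3-degree G v =
  length (filter (λ p → (proj₁ p <? proj₂ p) ×-dec
                        (adj? G v (proj₁ p) ×-dec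
                        (adj? G v (proj₂ p) ×-dec adj? G (proj₁ p) (proj₂ p))))
                 (cartesianProduct (allFin (n G)) (allFin (n G))))

Regular : Graph → Set
Regular G = ∀ u v → degree G u ≡ degree G v

K3-Regular : Graph → Set
K3-Regular G = ∀ u v → K3-degree G u ≡ K3-degree G v

-- Vertex set V(G₁) × V(G₂) is encoded as
-- Fin (n₁ * n₂) via the bijection remQuot / combine of Data.Fin.
-- (u , v) ~ (u' , v')  iff  (u ≡ u' and v ~ v' in G₂) or (v ≡ v' and u ~ u' in G₁).
open import Data.Fin using (remQuot)
open import Data.Sum using (_⊎_; inj₁; inj₂)
open import Relation.Nullary.Decidable using (_⊎-dec_)
import Relation.Binary.PropositionalEquality as Eq
open import Data.Empty using (⊥-elim)

module _ (G₁ G₂ : Graph) where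
  private
    V : Set
    V = Fin (n G₁ * n G₂)
    fst : V → Fin (n G₁)
    fst x = proj₁ (remQuot {n G₁} (n G₂) x)
    snd : V → Fin (n G₂)
    snd x = proj₂ (remQuot {n G₁} (n G₂) x)

  □Adj : V → V → Set
  □Adj x y = (fst x ≡ fst y × Adj G₂ (snd x) (snd y))
           ⊎ (snd x ≡ snd y × Adj G₁ (fst x) (fst y))

  private
    □adj? : ∀ x y → Dec (□Adj x y)
    □adj? x y = ((fst x ≟ fst y) ×-dec adj? G₂ (snd x) (snd y))
              ⊎-dec ((snd x ≟ snd y) ×-dec adj? G₁ (fst x) (fst y))

    □irrefl : ∀ x → ¬ □Adj x x
    □irrefl x (inj₁ (_ , a)) = irrefl G₂ (snd x) a
    □irrefl x (inj₂ (_ , a)) = irrefl G₁ (fst x) a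

    □sym : ∀ {x y} → □Adj x y → □Adj y x
    □sym (inj₁ (e , a)) = inj₁ (Eq.sym e , sym G₂ a)
    □sym (inj₂ (e , a)) = inj₂ (Eq.sym e , sym G₁ a)

  _□_ : Graph
  _□_ = record { n = n G₁ * n G₂ ; Adj = □Adj ; adj? = □adj?
               ; irrefl = □irrefl ; sym = □sym }

NonEmpty : Graph → Set
NonEmpty G = Fin (n G)

-- An edge of G₁ □ G₂ changes exactly one coordinate, so the neighbours of (u , v) are the
-- (u , j) with j ~ v together with the (i , v) with i ~ u, and a triangle through (u , v)
-- cannot mix the two kinds of edge: it lies in the row {u} × V(G₂), a copy of G₂, or in the
-- column V(G₁) × {v}, a copy of G₁.  Hence both the degree and the K₃-degree of (u , v) are
-- the sum of those of u in G₁ and of v in G₂, and a function of the form g u + h v on a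
-- nonempty product is constant exactly when g and h are.

module Submission where

open import Defs hiding (n; sym)
open Graph using () renaming (n to order)
open import Data.Bool.Base using (if_then_else_)
open import Data.Empty using (⊥-elim)
open import Data.Fin as Fin using (Fin; zero; suc; _↑ˡ_; _↑ʳ_; combine; remQuot; _<_; _<?_)
open import Data.Fin.Properties
  using ( _≟_; punchInᵢ≢i; remQuot-combine; combine-remQuot; toℕ-combine; combine-monoˡ-<
        ; <-cmp; <-irrefl)
open import Data.List.Base using (List; length; filter; tabulate; cartesianProduct; map; _++_)
open import Data.List.Properties using (length-++; filter-++; map-tabulate)
open import Data.Nat.Base as ℕ using (ℕ; _+_; _*_)
open import Data.Nat.Properties
  using ( +-0-commutativeMonoid; +-assoc; +-comm; +-identityʳ; +-cancelˡ-≡; +-cancelʳ-≡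
        ; +-cancelˡ-<; +-monoʳ-<; <-asym)
open import Data.Product.Base using (_×_; _,_; proj₁; proj₂)
open import Data.Sum.Base using (_⊎_; inj₁; inj₂)
open import Level using (Level)
open import Function.Base using (id; _∘_)
open import Function.Bundles using (_⇔_; mk⇔; Equivalence)
open import Relation.Nullary using (¬_; Dec; yes; no; does)
open import Relation.Nullary.Decidable using (_×-dec_; _⊎-dec_; dec-false; does-⇔)
open import Relation.Unary using (Pred; Decidable)
open import Relation.Binary.Definitions using (tri<; tri≈; tri>)
open import Relation.Binary.PropositionalEquality
  using (_≡_; _≢_; refl; sym; trans; cong; cong₂; subst₂; module ≡-Reasoning)
open import Algebra.Properties.CommutativeMonoid.Sum +-0-commutativeMonoid
  using (sum; sum-syntax; ∑-distrib-+; sum-cong-≗; sum-replicate-zero; sum-remove)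

open ≡-Reasoning

private variable
  a b p q : Level
  A : Set a
  B : Set b
  P : Set p
  Q : Set q
  m n : ℕ

𝟙 : Dec P → ℕ
𝟙 P? = if does P? then 1 else 0

𝟙-⇔ : P ⇔ Q → (P? : Dec P) (Q? : Dec Q) → 𝟙 P? ≡ 𝟙 Q?
𝟙-⇔ P⇔Q P? Q? = cong (if_then 1 else 0) (does-⇔ P⇔Q P? Q?)

𝟙-false : (P? : Dec P) → ¬ P → 𝟙 P? ≡ 0
𝟙-false P? ¬p = cong (if_then 1 else 0) (dec-false P? ¬p)

𝟙-⊎ : (P? : Dec P) (Q? : Dec Q) → ¬ (P × Q) → 𝟙 (P? ⊎-dec Q?) ≡ 𝟙 P? + 𝟙 Q?
𝟙-⊎ (yes p) (yes q) ¬p×q = ⊥-elim (¬p×q (p , q))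
𝟙-⊎ (yes _) (no _)  _    = refl
𝟙-⊎ (no _)  (yes _) _    = refl
𝟙-⊎ (no _)  (no _)  _    = refl

𝟙-refl-× : {x : A} (x≟x : Dec (x ≡ x)) (P? : Dec P) → 𝟙 (x≟x ×-dec P?) ≡ 𝟙 P?
𝟙-refl-× x≟x P? = 𝟙-⇔ (mk⇔ proj₂ (refl ,_)) (x≟x ×-dec P?) P?

∑-zero : (f : Fin n → ℕ) → (∀ i → f i ≡ 0) → ∑[ i < n ] f i ≡ 0
∑-zero {n} f f≡0 = trans (sum-cong-≗ f≡0) (sum-replicate-zero n)

∑-δ : (f : Fin n → ℕ) (u : Fin n) → (∀ i → i ≢ u → f i ≡ 0) → ∑[ i < n ] f i ≡ f u
∑-δ {ℕ.suc _} f u f≡0 = begin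
  sum f                               ≡⟨ sum-remove {i = u} f ⟩
  f u + sum (f ∘ Fin.punchIn u)       ≡⟨ cong (f u +_) (∑-zero _ (λ j → f≡0 _ (punchInᵢ≢i u j))) ⟩
  f u + 0                             ≡⟨ +-identityʳ (f u) ⟩
  f u                                 ∎

∑-↑ : (f : Fin (m + n) → ℕ) →
      ∑[ x < m + n ] f x ≡ ∑[ i < m ] f (i ↑ˡ n) + ∑[ j < n ] f (m ↑ʳ j)
∑-↑ {ℕ.zero} f = refl
∑-↑ {ℕ.suc m} {n} f = trans (cong (f zero +_) (∑-↑ {m} (f ∘ suc))) (sym (+-assoc (f zero) _ _))

∑-combine : ∀ m n (f : Fin (m * n) → ℕ) →
            ∑[ x < m * n ] f x ≡ ∑[ i < m ] ∑[ j < n ] f (combine i j)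
∑-combine ℕ.zero    n f = refl
∑-combine (ℕ.suc m) n f =
  trans (∑-↑ {n} f) (cong (∑[ j < n ] f (j ↑ˡ m * n) +_) (∑-combine m n (f ∘ (n ↑ʳ_))))

∑²-cong : {f g : Fin m → Fin n → ℕ} → (∀ i j → f i j ≡ g i j) →
          ∑[ i < m ] ∑[ j < n ] f i j ≡ ∑[ i < m ] ∑[ j < n ] g i j
∑²-cong f≡g = sum-cong-≗ (λ i → sum-cong-≗ (f≡g i))

∑²-distrib-+ : (f g : Fin m → Fin n → ℕ) →
               ∑[ i < m ] ∑[ j < n ] (f i j + g i j) ≡
               ∑[ i < m ] ∑[ j < n ] f i j + ∑[ i < m ] ∑[ j < n ] g i j
∑²-distrib-+ {n = n} f g =
  trans (sum-cong-≗ (λ i → ∑-distrib-+ (f i) (g i)))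
        (∑-distrib-+ (λ i → ∑[ j < n ] f i j) (λ i → ∑[ j < n ] g i j))

∑²-zero : (f : Fin m → Fin n → ℕ) → (∀ i j → f i j ≡ 0) → ∑[ i < m ] ∑[ j < n ] f i j ≡ 0
∑²-zero f f≡0 = ∑-zero _ (λ i → ∑-zero (f i) (f≡0 i))

∑²-row : (f : Fin m → Fin n → ℕ) (u : Fin m) → (∀ i j → i ≢ u → f i j ≡ 0) →
         ∑[ i < m ] ∑[ j < n ] f i j ≡ ∑[ j < n ] f u j
∑²-row f u f≡0 = ∑-δ _ u (λ i i≢u → ∑-zero (f i) (λ j → f≡0 i j i≢u))

∑²-column : (f : Fin m → Fin n → ℕ) (v : Fin n) → (∀ i j → j ≢ v → f i j ≡ 0) →
            ∑[ i < m ] ∑[ j < n ] f i j ≡ ∑[ i < m ] f i v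
∑²-column f v f≡0 = sum-cong-≗ (λ i → ∑-δ (f i) v (f≡0 i))

count-tabulate : {P : Pred A p} (P? : Decidable P) (f : Fin n → A) →
                 length (filter P? (tabulate f)) ≡ ∑[ i < n ] 𝟙 (P? (f i))
count-tabulate {n = ℕ.zero}  P? f = refl
count-tabulate {n = ℕ.suc n} P? f with P? (f zero)
... | yes _ = cong ℕ.suc (count-tabulate P? (f ∘ suc))
... | no _  = count-tabulate P? (f ∘ suc)

count-cartesianProduct : {P : Pred (A × B) p} (P? : Decidable P) (f : Fin m → A) (g : Fin n → B) →
                         length (filter P? (cartesianProduct (tabulate f) (tabulate g))) ≡
                         ∑[ i < m ] ∑[ j < n ] 𝟙 (P? (f i , g j))
count-cartesianProduct {m = ℕ.zero}  P? f g = refl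
count-cartesianProduct {A = A} {B = B} {m = ℕ.suc m} {n = n} P? f g = begin
  length (filter P? (first ++ rest))                  ≡⟨ cong length (filter-++ P? first rest) ⟩
  length (filter P? first ++ filter P? rest)          ≡⟨ length-++ (filter P? first) ⟩
  length (filter P? first) + length (filter P? rest)
    ≡⟨ cong₂ _+_ (trans (cong (length ∘ filter P?) (map-tabulate g (f zero ,_)))
                        (count-tabulate P? ((f zero ,_) ∘ g)))
                 (count-cartesianProduct P? (f ∘ suc) g) ⟩
  ∑[ j < n ] 𝟙 (P? (f zero , g j)) + ∑[ i < m ] ∑[ j < n ] 𝟙 (P? (f (suc i) , g j)) ∎
  where
  first rest : List (A × B)
  first = map (f zero ,_) (tabulate g)
  rest  = cartesianProduct (tabulate (f ∘ suc)) (tabulate g)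

combine-<⇔ : {i k : Fin m} {j l : Fin n} →
             combine i j < combine k l ⇔ (i < k ⊎ i ≡ k × j < l)
combine-<⇔ {n = n} {i} {k} {j} {l} = mk⇔ to from
  where
  to : combine i j < combine k l → i < k ⊎ i ≡ k × j < l
  to lt with <-cmp i k
  ... | tri< i<k _ _ = inj₁ i<k
  ... | tri≈ _ refl _ = inj₂ (refl , +-cancelˡ-< (n * Fin.toℕ i) (Fin.toℕ j) (Fin.toℕ l)
                                       (subst₂ ℕ._<_ (toℕ-combine i j) (toℕ-combine i l) lt))
  ... | tri> _ _ k<i = ⊥-elim (<-asym lt (combine-monoˡ-< l j k<i))
  from : i < k ⊎ i ≡ k × j < l → combine i j < combine k l
  from (inj₁ i<k)         = combine-monoˡ-< j l i<k
  from (inj₂ (refl , j<l)) = subst₂ ℕ._<_ (sym (toℕ-combine i j)) (sym (toℕ-combine i l))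
                                    (+-monoʳ-< (n * Fin.toℕ i) j<l)

combine-<-sameRow : {i : Fin m} {j l : Fin n} → combine i j < combine i l → j < l
combine-<-sameRow {m} {i = i} lt with Equivalence.to (combine-<⇔ {m} {i = i} {k = i}) lt
... | inj₁ i<i        = ⊥-elim (<-irrefl refl i<i)
... | inj₂ (_ , j<l)  = j<l

combine-<-sameColumn : {i k : Fin m} {j : Fin n} → combine i j < combine k j → i < k
combine-<-sameColumn {m} {j = j} lt with Equivalence.to (combine-<⇔ {m} {j = j} {l = j}) lt
... | inj₁ i<k        = i<k
... | inj₂ (_ , j<j)  = ⊥-elim (<-irrefl refl j<j)

Constant : (Fin n → ℕ) → Set
Constant f = ∀ x y → f x ≡ f y

constant⇔constant-summands : (f : Fin (m * n) → ℕ) (g : Fin m → ℕ) (h : Fin n → ℕ) →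
                             (∀ i j → f (combine i j) ≡ g i + h j) → Fin m → Fin n →
                             Constant f ⇔ (Constant g × Constant h)
constant⇔constant-summands {m} {n} f g h f≡g+h i₀ j₀ = mk⇔
  (λ f-const → (λ i i′ → +-cancelʳ-≡ (h j₀) (g i) (g i′) (via-f f-const (i , j₀) (i′ , j₀)))
             , (λ j j′ → +-cancelˡ-≡ (g i₀) (h j) (h j′) (via-f f-const (i₀ , j) (i₀ , j′))))
  λ (g-const , h-const) x y →
    trans (f≡g+h-remQuot x) (trans (cong₂ _+_ (g-const _ _) (h-const _ _)) (sym (f≡g+h-remQuot y)))
  where
  via-f : Constant f → ∀ p q → g (proj₁ p) + h (proj₂ p) ≡ g (proj₁ q) + h (proj₂ q)
  via-f f-const (i , j) (k , l) = trans (sym (f≡g+h i j)) (trans (f-const _ _) (f≡g+h k l))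

  f≡g+h-remQuot : ∀ x → f x ≡ g (proj₁ (remQuot {m} n x)) + h (proj₂ (remQuot {m} n x))
  f≡g+h-remQuot x =
    trans (cong f (sym (combine-remQuot {m} n x))) (f≡g+h (proj₁ (remQuot {m} n x)) (proj₂ (remQuot {m} n x)))

-- triangle? G x is the filter predicate of K3-degree G x, so K3-degree unfolds to a count of it.
Triangle : (G : Graph) → Fin (order G) → Fin (order G) × Fin (order G) → Set
Triangle G x (y , z) = y < z × Adj G x y × Adj G x z × Adj G y z

triangle? : (G : Graph) (x : Fin (order G)) → Decidable (Triangle G x)
triangle? G x (y , z) = (y <? z) ×-dec (adj? G x y ×-dec (adj? G x z ×-dec adj? G y z))

module _ (G₁ G₂ : Graph) where
  private
    G : Graph
    G = G₁ □ G₂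

    Vertex : Set
    Vertex = Fin (order G₁) × Fin (order G₂)

  -- Adj G x y unfolds to CoordAdj (remQuot _ x) (remQuot _ y).
  CoordAdj : Vertex → Vertex → Set
  CoordAdj (u , v) (i , j) = (u ≡ i × Adj G₂ v j) ⊎ (v ≡ j × Adj G₁ u i)

  adj-combine⇔ : ∀ u v i j → Adj G (combine u v) (combine i j) ⇔ CoordAdj (u , v) (i , j)
  adj-combine⇔ u v i j = mk⇔ (subst₂ CoordAdj (remQuot-combine u v) (remQuot-combine i j))
                             (subst₂ CoordAdj (sym (remQuot-combine u v)) (sym (remQuot-combine i j)))

  degree-□ : ∀ u v → degree G (combine u v) ≡ degree G₁ u + degree G₂ v
  degree-□ u v = begin
    degree G x
      ≡⟨ count-tabulate (adj? G x) id ⟩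
    ∑[ y < order G ] 𝟙 (adj? G x y)
      ≡⟨ ∑-combine (order G₁) (order G₂) _ ⟩
    ∑[ i < order G₁ ] ∑[ j < order G₂ ] 𝟙 (adj? G x (combine i j))
      ≡⟨ ∑²-cong split ⟩
    ∑[ i < order G₁ ] ∑[ j < order G₂ ] (𝟙 (row? i j) + 𝟙 (column? i j))
      ≡⟨ ∑²-distrib-+ (λ i j → 𝟙 (row? i j)) (λ i j → 𝟙 (column? i j)) ⟩
    ∑[ i < order G₁ ] ∑[ j < order G₂ ] 𝟙 (row? i j) +
    ∑[ i < order G₁ ] ∑[ j < order G₂ ] 𝟙 (column? i j)
      ≡⟨ cong₂ _+_ (∑²-row _ u (λ i j i≢u → 𝟙-false (row? i j) (i≢u ∘ sym ∘ proj₁)))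
                   (∑²-column _ v (λ i j j≢v → 𝟙-false (column? i j) (j≢v ∘ sym ∘ proj₁))) ⟩
    ∑[ j < order G₂ ] 𝟙 (row? u j) + ∑[ i < order G₁ ] 𝟙 (column? i v)
      ≡⟨ cong₂ _+_ (sum-cong-≗ (λ j → 𝟙-refl-× (u ≟ u) (adj? G₂ v j)))
                   (sum-cong-≗ (λ i → 𝟙-refl-× (v ≟ v) (adj? G₁ u i))) ⟩
    ∑[ j < order G₂ ] 𝟙 (adj? G₂ v j) + ∑[ i < order G₁ ] 𝟙 (adj? G₁ u i)
      ≡⟨ +-comm (∑[ j < order G₂ ] 𝟙 (adj? G₂ v j)) _ ⟩
    ∑[ i < order G₁ ] 𝟙 (adj? G₁ u i) + ∑[ j < order G₂ ] 𝟙 (adj? G₂ v j)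
      ≡⟨ cong₂ _+_ (count-tabulate (adj? G₁ u) id) (count-tabulate (adj? G₂ v) id) ⟨
    degree G₁ u + degree G₂ v ∎
    where
    x : Fin (order G)
    x = combine u v

    row? : ∀ i j → Dec (u ≡ i × Adj G₂ v j)
    row? i j = (u ≟ i) ×-dec adj? G₂ v j

    column? : ∀ i j → Dec (v ≡ j × Adj G₁ u i)
    column? i j = (v ≟ j) ×-dec adj? G₁ u i

    split : ∀ i j → 𝟙 (adj? G x (combine i j)) ≡ 𝟙 (row? i j) + 𝟙 (column? i j)
    split i j = trans (𝟙-⇔ (adj-combine⇔ u v i j) (adj? G x (combine i j)) (row? i j ⊎-dec column? i j))
                      (𝟙-⊎ (row? i j) (column? i j) λ { ((refl , _) , (_ , uAu)) → irrefl G₁ u uAu })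

  RowTriangle ColumnTriangle : Vertex → Vertex → Vertex → Set
  RowTriangle    (u , v) (i , j) (k , l) = u ≡ i × u ≡ k × Triangle G₂ v (j , l)
  ColumnTriangle (u , v) (i , j) (k , l) = v ≡ j × v ≡ l × Triangle G₁ u (i , k)

  -- In each mixed case two of the equations identify endpoints of an edge, contradicting irreflexivity.
  row-or-column-triangle :
    ∀ {u v i j k l} → combine i j < combine k l →
    CoordAdj (u , v) (i , j) → CoordAdj (u , v) (k , l) → CoordAdj (i , j) (k , l) →
    RowTriangle (u , v) (i , j) (k , l) ⊎ ColumnTriangle (u , v) (i , j) (k , l)
  row-or-column-triangle lt (inj₁ (refl , a)) (inj₁ (refl , b)) (inj₁ (_ , c)) =
    inj₁ (refl , refl , combine-<-sameRow {order G₁} lt , a , b , c)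
  row-or-column-triangle lt (inj₂ (refl , a)) (inj₂ (refl , b)) (inj₂ (_ , c)) =
    inj₂ (refl , refl , combine-<-sameColumn {order G₁} lt , a , b , c)
  row-or-column-triangle {u}     _ (inj₁ (refl , _)) (inj₁ (refl , _)) (inj₂ (_ , c))    = ⊥-elim (irrefl G₁ u c)
  row-or-column-triangle {u}     _ (inj₁ (refl , _)) (inj₂ (refl , b)) (inj₁ (refl , _)) = ⊥-elim (irrefl G₁ u b)
  row-or-column-triangle {v = v} _ (inj₁ (refl , a)) (inj₂ (refl , _)) (inj₂ (refl , _)) = ⊥-elim (irrefl G₂ v a)
  row-or-column-triangle {u}     _ (inj₂ (refl , a)) (inj₁ (refl , _)) (inj₁ (refl , _)) = ⊥-elim (irrefl G₁ u a)
  row-or-column-triangle {v = v} _ (inj₂ (refl , _)) (inj₁ (refl , b)) (inj₂ (refl , _)) = ⊥-elim (irrefl G₂ v b)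
  row-or-column-triangle {v = v} _ (inj₂ (refl , _)) (inj₂ (refl , _)) (inj₁ (_ , c))    = ⊥-elim (irrefl G₂ v c)

  triangle-combine⇔ : ∀ u v i j k l →
    Triangle G (combine u v) (combine i j , combine k l) ⇔
    (RowTriangle (u , v) (i , j) (k , l) ⊎ ColumnTriangle (u , v) (i , j) (k , l))
  triangle-combine⇔ u v i j k l = mk⇔
    (λ (lt , a , b , c) → row-or-column-triangle lt (to (adj-combine⇔ u v i j) a) (to (adj-combine⇔ u v k l) b)
                                                      (to (adj-combine⇔ i j k l) c))
    λ { (inj₁ (refl , refl , j<l , a , b , c)) →
          from (combine-<⇔ {order G₁}) (inj₂ (refl , j<l)) , from (adj-combine⇔ u v u j) (inj₁ (refl , a)) ,
          from (adj-combine⇔ u v u l) (inj₁ (refl , b)) , from (adj-combine⇔ u j u l) (inj₁ (refl , c))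
      ; (inj₂ (refl , refl , i<k , a , b , c)) →
          from (combine-<⇔ {order G₁}) (inj₁ i<k) , from (adj-combine⇔ u v i v) (inj₂ (refl , a)) ,
          from (adj-combine⇔ u v k v) (inj₂ (refl , b)) , from (adj-combine⇔ i v k v) (inj₂ (refl , c)) }
    where open Equivalence

  K3-degree-□ : ∀ u v → K3-degree G (combine u v) ≡ K3-degree G₁ u + K3-degree G₂ v
  K3-degree-□ u v = begin
    K3-degree G x
      ≡⟨ count-cartesianProduct (triangle? G x) id id ⟩
    ∑[ y < order G ] ∑[ z < order G ] 𝟙 (triangle? G x (y , z))
      ≡⟨ ∑-combine (order G₁) (order G₂) _ ⟩
    ∑[ i < order G₁ ] ∑[ j < order G₂ ] ∑[ z < order G ] 𝟙 (triangle? G x (combine i j , z))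
      ≡⟨ ∑²-cong {order G₁} {order G₂} (λ i j → ∑-combine (order G₁) (order G₂) _) ⟩
    ∑⁴ (λ i j k l → 𝟙 (triangle? G x (combine i j , combine k l)))
      ≡⟨ ∑²-cong (λ i j → ∑²-cong (split i j)) ⟩
    ∑⁴ (λ i j k l → 𝟙 (row? i j k l) + 𝟙 (column? i j k l))
      ≡⟨ trans (∑²-cong (λ i j → ∑²-distrib-+ (row i j) (column i j)))
               (∑²-distrib-+ (λ i j → ∑² (row i j)) (λ i j → ∑² (column i j))) ⟩
    ∑⁴ row + ∑⁴ column
      ≡⟨ +-comm (∑⁴ row) (∑⁴ column) ⟩
    ∑⁴ column + ∑⁴ row
      ≡⟨ cong₂ _+_ columns rows ⟩
    K3-degree G₁ u + K3-degree G₂ v ∎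
    where
    x : Fin (order G)
    x = combine u v

    ∑² : (Fin (order G₁) → Fin (order G₂) → ℕ) → ℕ
    ∑² f = ∑[ k < order G₁ ] ∑[ l < order G₂ ] f k l

    ∑⁴ : (Fin (order G₁) → Fin (order G₂) → Fin (order G₁) → Fin (order G₂) → ℕ) → ℕ
    ∑⁴ f = ∑[ i < order G₁ ] ∑[ j < order G₂ ] ∑² (f i j)

    row? : ∀ i j k l → Dec (RowTriangle (u , v) (i , j) (k , l))
    row? i j k l = (u ≟ i) ×-dec ((u ≟ k) ×-dec triangle? G₂ v (j , l))

    column? : ∀ i j k l → Dec (ColumnTriangle (u , v) (i , j) (k , l))
    column? i j k l = (v ≟ j) ×-dec ((v ≟ l) ×-dec triangle? G₁ u (i , k))

    row column : Fin (order G₁) → Fin (order G₂) → Fin (order G₁) → Fin (order G₂) → ℕ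
    row    i j k l = 𝟙 (row? i j k l)
    column i j k l = 𝟙 (column? i j k l)

    split : ∀ i j k l → 𝟙 (triangle? G x (combine i j , combine k l)) ≡ row i j k l + column i j k l
    split i j k l =
      trans (𝟙-⇔ (triangle-combine⇔ u v i j k l) (triangle? G x (combine i j , combine k l))
                 (row? i j k l ⊎-dec column? i j k l))
            (𝟙-⊎ (row? i j k l) (column? i j k l) λ { ((refl , _ , _ , vAj , _) , (refl , _)) → irrefl G₂ v vAj })

    rows : ∑⁴ row ≡ K3-degree G₂ v
    rows = begin
      ∑⁴ row
        ≡⟨ ∑²-row _ u (λ i j i≢u → ∑²-zero _ (λ k l → 𝟙-false (row? i j k l) (i≢u ∘ sym ∘ proj₁))) ⟩
      ∑[ j < order G₂ ] ∑² (row u j)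
        ≡⟨ sum-cong-≗ (λ j → ∑²-row _ u (λ k l k≢u →
             𝟙-false (row? u j k l) (k≢u ∘ sym ∘ proj₁ ∘ proj₂))) ⟩
      ∑[ j < order G₂ ] ∑[ l < order G₂ ] row u j u l
        ≡⟨ ∑²-cong (λ j l → trans (𝟙-refl-× (u ≟ u) ((u ≟ u) ×-dec triangle? G₂ v (j , l)))
                                     (𝟙-refl-× (u ≟ u) (triangle? G₂ v (j , l)))) ⟩
      ∑[ j < order G₂ ] ∑[ l < order G₂ ] 𝟙 (triangle? G₂ v (j , l))
        ≡⟨ count-cartesianProduct (triangle? G₂ v) id id ⟨
      K3-degree G₂ v ∎

    columns : ∑⁴ column ≡ K3-degree G₁ u
    columns = begin
      ∑⁴ column
        ≡⟨ ∑²-column _ v (λ i j j≢v → ∑²-zero _ (λ k l → 𝟙-false (column? i j k l) (j≢v ∘ sym ∘ proj₁))) ⟩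
      ∑[ i < order G₁ ] ∑² (column i v)
        ≡⟨ sum-cong-≗ (λ i → ∑²-column _ v (λ k l l≢v →
             𝟙-false (column? i v k l) (l≢v ∘ sym ∘ proj₁ ∘ proj₂))) ⟩
      ∑[ i < order G₁ ] ∑[ k < order G₁ ] column i v k v
        ≡⟨ ∑²-cong (λ i k → trans (𝟙-refl-× (v ≟ v) ((v ≟ v) ×-dec triangle? G₁ u (i , k)))
                                     (𝟙-refl-× (v ≟ v) (triangle? G₁ u (i , k)))) ⟩
      ∑[ i < order G₁ ] ∑[ k < order G₁ ] 𝟙 (triangle? G₁ u (i , k))
        ≡⟨ count-cartesianProduct (triangle? G₁ u) id id ⟨
      K3-degree G₁ u ∎

theorem4p2 : (G₁ G₂ : Graph) → NonEmpty G₁ → NonEmpty G₂ →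
    (Regular (G₁ □ G₂) × K3-Regular (G₁ □ G₂)) ⇔
    ((Regular G₁ × K3-Regular G₁) × (Regular G₂ × K3-Regular G₂))
theorem4p2 G₁ G₂ u v = mk⇔
  (λ (reg , k3reg) → (proj₁ (Deg.to reg) , proj₁ (K3.to k3reg)) , (proj₂ (Deg.to reg) , proj₂ (K3.to k3reg)))
  (λ ((reg₁ , k3reg₁) , (reg₂ , k3reg₂)) → Deg.from (reg₁ , reg₂) , K3.from (k3reg₁ , k3reg₂))
  where
  module Deg = Equivalence (constant⇔constant-summands
    (degree (G₁ □ G₂)) (degree G₁) (degree G₂) (degree-□ G₁ G₂) u v)
  module K3 = Equivalence (constant⇔constant-summands
    (K3-degree (G₁ □ G₂)) (K3-degree G₁) (K3-degree G₂) (K3-degree-□ G₁ G₂) u v)
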